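{- Let $M$ be a matching on $[n]$ with $\alpha n$ edges and let $M\in\{0,1\}^{\alpha n\times n}$ also denote its incidence matrix (rows indexed by edges $e$, $M_{eu}=1$ iff $e$ is incident on $u$). Let $g:\{0,1\}^{\alpha n}\to\{0,1\}^s$ for some $s>0$, let $a\in\{0,1\}^s$, let $q:\{0,1\}^{\alpha n}\to\{0,1\}$ be the indicator of $A_{reduced}=\{z\in\{0,1\}^{\alpha n}:g(z)=a\}$, and let $f:\{0,1\}^n\to\{0,1\}$ be the indicator of $A_{full}=\{x\in\{0,1\}^n: g(Mx)=a\}$ (with $Mx$ computed mod 2). Then for every $v\in\{0,1\}^n$ (viewed as a subset of $[n]$): $\widehat f(v)=0$ if $v$ cannot be perfectly matched via edges of $M$, and otherwise $\widehat f(v)=\widehat q(w)$, where $w\in\{0,1\}^{M}$ is the set of edges of $M$ perfectly matching $v$. Moreover, this perfect matching, when it exists, is unique; its existence is equivalent to the existence of $w\in\{0,1\}^{\alpha n}$ with $v=M^Tw$. Thus the only nonzero Fourier coefficients of $f$ are of the form $\widehat f(M^Tw)=\widehat q(w)$, and nonzero weight-$k$ coefficients of $\widehat q$ are in one-to-one correspondence with nonzero weight-$2k$ coefficients of $\widehat f$.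
   Context: Fourier transform on $\{0,1\}^N$: $\widehat p(v)=2^{ -N}\sum_{x\in\{0,1\}^N}p(x)(-1)^{x\cdot v}$ (here $N=n$ for $f$ and $N=\alpha n$ for $q$). -}

module Defs where

open import Data.Nat as ℕ using (ℕ; zero; suc)
open import Data.Bool using (Bool; true; false; _xor_; _∧_; if_then_else_)
open import Data.Fin using (Fin)
open import Data.Vec using (Vec; []; _∷_; lookup; tabulate; count; foldr)
open import Data.List using (List; []; _∷_; map; _++_)
open import Data.Rational using (ℚ; 0ℚ; 1ℚ; ½; _+_; _*_; -_)
open import Data.Product using (Σ; _×_; ∃; ∃-syntax)
open import Relation.Binary.PropositionalEquality using (_≡_; _≢_)
open import Relation.Nullary using (¬_)
open import Function.Bundles using (_⇔_)

-- {0,1}^N as Boolean vectors (true = 1)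
Bits : ℕ → Set
Bits N = Vec Bool N

allBits : (N : ℕ) → List (Bits N)
allBits zero    = [] ∷ []
allBits (suc N) = map (false ∷_) (allBits N) ++ map (true ∷_) (allBits N)

dot : ∀ {N} → Bits N → Bits N → Bool
dot []       []       = false
dot (x ∷ xs) (y ∷ ys) = (x ∧ y) xor dot xs ys

weight : ∀ {N} → Bits N → ℕ
weight []           = zero
weight (true ∷ xs)  = suc (weight xs)
weight (false ∷ xs) = weight xs

boolℚ : Bool → ℚ
boolℚ true  = 1ℚ
boolℚ false = 0ℚ

sign : Bool → ℚ
sign false = 1ℚ
sign true  = - 1ℚ

halfPow : ℕ → ℚ
halfPow zero    = 1ℚ
halfPow (suc N) = ½ * halfPow N

sumℚ : List ℚ → ℚ
sumℚ []       = 0ℚ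
sumℚ (x ∷ xs) = x + sumℚ xs

fourier : ∀ {N} → (Bits N → Bool) → Bits N → ℚ
fourier {N} p v = halfPow N * sumℚ (map (λ x → boolℚ (p x) * sign (dot x v)) (allBits N))

record Matching (n m : ℕ) : Set where
  field
    end₁ : Fin m → Fin n
    end₂ : Fin m → Fin n
    proper : ∀ e → end₁ e ≢ end₂ e
    disjoint : ∀ e e' → e ≢ e' →
      (end₁ e ≢ end₁ e') × (end₁ e ≢ end₂ e') × (end₂ e ≢ end₁ e') × (end₂ e ≢ end₂ e')
open Matching public

Incident : ∀ {n m} → Matching n m → Fin m → Fin n → Set
Incident M e u = (u ≡ end₁ M e) Data.Sum.⊎ (u ≡ end₂ M e)
  where import Data.Sum

incidence : ∀ {n m} → Matching n m → Fin m → Fin n → Bool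
incidence {n} M e u = Data.Bool.Base._∨_ (⌊ u Data.Fin.≟ end₁ M e ⌋) (⌊ u Data.Fin.≟ end₂ M e ⌋)
  where
    import Data.Bool.Base
    import Data.Fin
    open import Relation.Nullary.Decidable using (⌊_⌋)

row : ∀ {n m} → Matching n m → Fin m → Bits n
row M e = tabulate (incidence M e)

col : ∀ {n m} → Matching n m → Fin n → Bits m
col M u = tabulate (λ e → incidence M e u)

mulM : ∀ {n m} → Matching n m → Bits n → Bits m
mulM M x = tabulate (λ e → dot (row M e) x)

mulMT : ∀ {n m} → Matching n m → Bits m → Bits n
mulMT M w = tabulate (λ u → dot (col M u) w)

-- the set w of edges of M perfectly matches the vertex set v:
-- a vertex lies in v iff it is covered by an edge of w
-- (each vertex is then covered exactly once, since M is a matching)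
PerfectlyMatches : ∀ {n m} → Matching n m → Bits m → Bits n → Set
PerfectlyMatches {m = m} M w v =
  ∀ u → (lookup v u ≡ true) ⇔ (∃[ e ] (lookup w e ≡ true × Incident M e u))

Matchable : ∀ {n m} → Matching n m → Bits n → Set
Matchable {m = m} M v = ∃[ w ] PerfectlyMatches {m = m} M w v

indicator : ∀ {m s} → (Bits m → Bits s) → Bits s → Bits m → Bool
indicator g a z = ⌊ Data.Vec.Properties.≡-dec Data.Bool.Properties._≟_ (g z) a ⌋
  where
    import Data.Vec.Properties
    import Data.Bool.Properties
    open import Relation.Nullary.Decidable using (⌊_⌋)

module Submission where

-- Write f = q ∘ M, where M x is the mod-2 product of the incidence matrix of the matching with x.
-- The argument has an analytic half, valid for an arbitrary Boolean matrix A, and a combinatorial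
-- half, specific to matchings.
--
--   * Fourier analysis on {0,1}^N over ℚ: orthogonality of the characters χ_v(x) = (-1)^{x·v}
--     gives Fourier inversion q = Σ_w q̂(w) χ_w, and together with ⟨A x, w⟩ = ⟨x, Aᵀ w⟩ this yields
--     the composition formula  (q ∘ A)^(v) = Σ_w q̂(w) [Aᵀ w = v].  Hence (q ∘ A)^ vanishes off
--     the image of Aᵀ, and equals q̂(w) at Aᵀ w whenever Aᵀ is injective.
--   * Matchings: every vertex lies on at most one edge, so a column sum of the incidence matrix
--     has at most one nonzero term.  Consequently (Mᵀ w)_u is the bit of the edge covering u;
--     "w perfectly matches v" says exactly v = Mᵀ w; Mᵀ w can be read back at one endpoint of
--     each edge (so Mᵀ is injective and its image is decidable); and weight (Mᵀ w) = 2 weight w,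
--     by counting vertex-edge incidences in two ways.

open import Defs
open import Data.Nat as ℕ using (ℕ; suc)
import Data.Nat.Properties as ℕ
open import Data.Bool using (Bool; true; false; _∧_; _∨_; _xor_)
open import Data.Bool.Properties
  using (∧-assoc; ∧-comm; ∧-identityʳ; ∧-zeroʳ; xor-∧-commutativeRing; ⇔→≡)
  renaming (_≟_ to _≟ᴮ_)
open import Data.Fin as Fin using (Fin; _≟_; punchIn)
open import Data.Fin.Properties using (punchInᵢ≢i; any?)
open import Data.Vec using ([]; _∷_; lookup; tabulate)
open import Data.Vec.Properties using (lookup∘tabulate; ≡-dec)
open import Data.Vec.Relation.Binary.Pointwise.Extensional using (ext; Pointwise-≡⇒≡)
open import Data.Vec.Functional using (Vector; removeAt)
open import Data.Product using (_×_; _,_; ∃-syntax)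
open import Data.Sum using (inj₁; inj₂)
open import Data.Empty using (⊥)
open import Level using (0ℓ)
open import Algebra.Bundles using (CommutativeMonoid; CommutativeRing; Semiring)
import Algebra.Properties.CommutativeMonoid.Sum as CommutativeMonoidSum
import Algebra.Properties.Semiring.Sum as SemiringSum
open import Relation.Nullary using (¬_; Dec; yes; no; does; _⊎-dec_; contradiction)
open import Relation.Nullary.Decidable using (dec-true; dec-false; isYes≗does; decidable-stable)
open import Relation.Binary.PropositionalEquality
  using (_≡_; _≢_; refl; sym; trans; cong; cong₂; subst; module ≡-Reasoning)
open import Function using (_∘_)
open import Function.Bundles using (_⇔_; mk⇔; Equivalence)
import Function.Properties.Equivalence as ⇔

module SupportedSums {c ℓ} (C : CommutativeMonoid c ℓ) where
  open CommutativeMonoid C using (Carrier; _≈_; _∙_; ∙-congˡ; identityʳ; setoid) renaming (ε to 0#)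
  open CommutativeMonoidSum C using (sum; sum-cong-≋; sum-replicate-zero; sum-remove)
  open import Relation.Binary.Reasoning.Setoid setoid

  sum-zero : ∀ {k} (t : Vector Carrier k) → (∀ i → t i ≈ 0#) → sum t ≈ 0#
  sum-zero {k} t t≈0 = begin
    sum t                         ≈⟨ sum-cong-≋ t≈0 ⟩
    sum {k} (λ _ → 0#)            ≈⟨ sum-replicate-zero k ⟩
    0#                            ∎

  sum-single : ∀ {k} (t : Vector Carrier k) (j : Fin k) →
               (∀ i → i ≢ j → t i ≈ 0#) → sum t ≈ t j
  sum-single {suc k} t j off-j = begin
    sum t                     ≈⟨ sum-remove t ⟩
    t j ∙ sum (removeAt t j)  ≈⟨ ∙-congˡ (sum-zero (removeAt t j) (λ i → off-j (punchIn j i) (punchInᵢ≢i j i))) ⟩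
    t j ∙ 0#                  ≈⟨ identityʳ (t j) ⟩
    t j                       ∎

GF₂ : Semiring 0ℓ 0ℓ
GF₂ = CommutativeRing.semiring xor-∧-commutativeRing

module ⊕ = SemiringSum GF₂
module ⊕-support = SupportedSums (Semiring.+-commutativeMonoid GF₂)
module Σℕ = SemiringSum ℕ.+-*-semiring
module Σℕ-support = SupportedSums (Semiring.+-commutativeMonoid ℕ.+-*-semiring)

bitℕ : Bool → ℕ
bitℕ true  = 1
bitℕ false = 0

weight-sum : ∀ {N} (v : Bits N) → weight v ≡ Σℕ.sum (λ i → bitℕ (lookup v i))
weight-sum []          = refl
weight-sum (true ∷ v)  = cong suc (weight-sum v)
weight-sum (false ∷ v) = weight-sum v

point-mass : ∀ {k} (a : Fin k) → Σℕ.sum (λ u → bitℕ (does (u ≟ a))) ≡ 1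
point-mass a = trans
  (Σℕ-support.sum-single _ a (λ u u≢a → cong bitℕ (dec-false (u ≟ a) u≢a)))
  (cong bitℕ (dec-true (a ≟ a) refl))

dot-tabulate : ∀ {N} (f : Fin N → Bool) (v : Bits N) →
               dot (tabulate f) v ≡ ⊕.sum (λ i → f i ∧ lookup v i)
dot-tabulate f []      = refl
dot-tabulate f (b ∷ v) = cong ((f Fin.zero ∧ b) xor_) (dot-tabulate (f ∘ Fin.suc) v)

dot-comm : ∀ {N} (x y : Bits N) → dot x y ≡ dot y x
dot-comm []      []      = refl
dot-comm (a ∷ x) (b ∷ y) = cong₂ _xor_ (∧-comm a b) (dot-comm x y)

-- Matrix-vector products over GF(2) for an arbitrary Boolean m × n matrix A: A x and Aᵀ w.
-- For the incidence matrix of a matching these are definitionally mulM and mulMT.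
apply : ∀ {n m} → (Fin m → Fin n → Bool) → Bits n → Bits m
apply A x = tabulate (λ e → dot (tabulate (A e)) x)

applyᵀ : ∀ {n m} → (Fin m → Fin n → Bool) → Bits m → Bits n
applyᵀ A w = tabulate (λ u → dot (tabulate (λ e → A e u)) w)

-- The adjunction ⟨A x, w⟩ = ⟨x, Aᵀ w⟩: exchange the order of the double sum Σ_e Σ_u A_eu x_u w_e.
transpose : ∀ {n m} (A : Fin m → Fin n → Bool) (x : Bits n) (w : Bits m) →
            dot (apply A x) w ≡ dot x (applyᵀ A w)
transpose A x w = begin
  dot (apply A x) w
    ≡⟨ dot-tabulate _ w ⟩
  ⊕.sum (λ e → dot (tabulate (A e)) x ∧ lookup w e)
    ≡⟨ ⊕.sum-cong-≗ (λ e → trans (cong (_∧ lookup w e) (dot-tabulate (A e) x))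
                                  (⊕.*-distribʳ-sum (lookup w e) (λ u → A e u ∧ lookup x u))) ⟩
  ⊕.sum (λ e → ⊕.sum (λ u → (A e u ∧ lookup x u) ∧ lookup w e))
    ≡⟨ ⊕.∑-comm (λ e u → (A e u ∧ lookup x u) ∧ lookup w e) ⟩
  ⊕.sum (λ u → ⊕.sum (λ e → (A e u ∧ lookup x u) ∧ lookup w e))
    ≡⟨ ⊕.sum-cong-≗ (λ u → ⊕.sum-cong-≗ (λ e → swap₂₃ (A e u) (lookup x u) (lookup w e))) ⟩
  ⊕.sum (λ u → ⊕.sum (λ e → (A e u ∧ lookup w e) ∧ lookup x u))
    ≡⟨ ⊕.sum-cong-≗ (λ u → sym (trans (cong (_∧ lookup x u) (dot-tabulate (λ e → A e u) w))
                                       (⊕.*-distribʳ-sum (lookup x u) (λ e → A e u ∧ lookup w e)))) ⟩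
  ⊕.sum (λ u → dot (tabulate (λ e → A e u)) w ∧ lookup x u)
    ≡⟨ sym (dot-tabulate _ x) ⟩
  dot (applyᵀ A w) x
    ≡⟨ dot-comm (applyᵀ A w) x ⟩
  dot x (applyᵀ A w) ∎
  where
  open ≡-Reasoning
  swap₂₃ : ∀ a b c → (a ∧ b) ∧ c ≡ (a ∧ c) ∧ b
  swap₂₃ a b c = trans (∧-assoc a b c) (trans (cong (a ∧_) (∧-comm b c)) (sym (∧-assoc a c b)))

module Fourier where
  open import Data.List using (List; []; _∷_; map; _++_)
  open import Data.List.Properties using (map-∘)
  open import Data.Rational using (ℚ; 0ℚ; 1ℚ; ½; _+_; _*_; -_)
  open import Data.Rational.Properties
    using (+-identityˡ; +-identityʳ; +-assoc; *-assoc; *-identityˡ; *-zeroʳ; *-comm; *-distribˡ-+)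
  open import Data.Rational.Solver using (module +-*-Solver)
  open +-*-Solver using (solve; _:+_; _:*_; _:=_; con)
  open ≡-Reasoning

  module _ {A : Set} where

    sumOver : List A → (A → ℚ) → ℚ
    sumOver xs f = sumℚ (map f xs)

    sumOver-cong : ∀ xs {f g : A → ℚ} → (∀ x → f x ≡ g x) → sumOver xs f ≡ sumOver xs g
    sumOver-cong []       f≡g = refl
    sumOver-cong (x ∷ xs) f≡g = cong₂ _+_ (f≡g x) (sumOver-cong xs f≡g)

    sumOver-++ : ∀ xs ys (f : A → ℚ) → sumOver (xs ++ ys) f ≡ sumOver xs f + sumOver ys f
    sumOver-++ []       ys f = sym (+-identityˡ _)
    sumOver-++ (x ∷ xs) ys f = trans (cong (f x +_) (sumOver-++ xs ys f)) (sym (+-assoc (f x) _ _))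

    sumOver-zero : ∀ xs (f : A → ℚ) → (∀ x → f x ≡ 0ℚ) → sumOver xs f ≡ 0ℚ
    sumOver-zero []       f f≡0 = refl
    sumOver-zero (x ∷ xs) f f≡0 = cong₂ _+_ (f≡0 x) (sumOver-zero xs f f≡0)

    sumOver-+ : ∀ xs (f g : A → ℚ) → sumOver xs (λ x → f x + g x) ≡ sumOver xs f + sumOver xs g
    sumOver-+ []       f g = refl
    sumOver-+ (x ∷ xs) f g = trans (cong ((f x + g x) +_) (sumOver-+ xs f g))
      (solve 4 (λ a b c d → (a :+ b) :+ (c :+ d) := (a :+ c) :+ (b :+ d)) refl (f x) (g x) _ _)

    sumOver-*ˡ : ∀ xs (c : ℚ) (f : A → ℚ) → sumOver xs (λ x → c * f x) ≡ c * sumOver xs f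
    sumOver-*ˡ []       c f = sym (*-zeroʳ c)
    sumOver-*ˡ (x ∷ xs) c f = trans (cong (c * f x +_) (sumOver-*ˡ xs c f)) (sym (*-distribˡ-+ c (f x) _))

    sumOver-*ʳ : ∀ xs (c : ℚ) (f : A → ℚ) → sumOver xs (λ x → f x * c) ≡ sumOver xs f * c
    sumOver-*ʳ xs c f = begin
      sumOver xs (λ x → f x * c) ≡⟨ sumOver-cong xs (λ x → *-comm (f x) c) ⟩
      sumOver xs (λ x → c * f x) ≡⟨ sumOver-*ˡ xs c f ⟩
      c * sumOver xs f           ≡⟨ *-comm c _ ⟩
      sumOver xs f * c           ∎

  sumOver-swap : ∀ {A B : Set} (xs : List A) (ys : List B) (h : A → B → ℚ) →
                 sumOver xs (λ x → sumOver ys (h x)) ≡ sumOver ys (λ y → sumOver xs (λ x → h x y))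
  sumOver-swap []       ys h = sym (sumOver-zero ys _ (λ _ → refl))
  sumOver-swap (x ∷ xs) ys h =
    trans (cong (sumOver ys (h x) +_) (sumOver-swap xs ys h))
          (sym (sumOver-+ ys (h x) (λ y → sumOver xs (λ x′ → h x′ y))))

  Σᶜ : (N : ℕ) → (Bits N → ℚ) → ℚ
  Σᶜ N h = sumOver (allBits N) h

  Σᶜ-suc : ∀ N (h : Bits (suc N) → ℚ) →
           Σᶜ (suc N) h ≡ Σᶜ N (λ x → h (false ∷ x)) + Σᶜ N (λ x → h (true ∷ x))
  Σᶜ-suc N h = begin
    sumOver (map (false ∷_) (allBits N) ++ map (true ∷_) (allBits N)) h
      ≡⟨ sumOver-++ (map (false ∷_) (allBits N)) _ h ⟩
    sumOver (map (false ∷_) (allBits N)) h + sumOver (map (true ∷_) (allBits N)) h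
      ≡⟨ cong₂ _+_ (cong sumℚ (sym (map-∘ (allBits N)))) (cong sumℚ (sym (map-∘ (allBits N)))) ⟩
    Σᶜ N (λ x → h (false ∷ x)) + Σᶜ N (λ x → h (true ∷ x)) ∎

  χ : ∀ {N} → Bits N → Bits N → ℚ
  χ v x = sign (dot x v)

  transform : ∀ {N} → (Bits N → ℚ) → Bits N → ℚ
  transform {N} Q v = halfPow N * Σᶜ N (λ x → Q x * χ v x)

  δ : ∀ {N} → Bits N → Bits N → ℚ
  δ u v = boolℚ (does (≡-dec _≟ᴮ_ u v))

  δ-refl : ∀ {N} (u : Bits N) → δ u u ≡ 1ℚ
  δ-refl u = cong boolℚ (dec-true (≡-dec _≟ᴮ_ u u) refl)

  δ-distinct : ∀ {N} {u v : Bits N} → u ≢ v → δ u v ≡ 0ℚ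
  δ-distinct {u = u} {v} u≢v = cong boolℚ (dec-false (≡-dec _≟ᴮ_ u v) u≢v)

  χ-sym : ∀ {N} (u v : Bits N) → χ u v ≡ χ v u
  χ-sym u v = cong sign (dot-comm v u)

  χ-true : ∀ {N} a (u x : Bits N) → χ (a ∷ u) (true ∷ x) ≡ sign a * χ u x
  χ-true false u x = sym (*-identityˡ (χ u x))
  χ-true true u x with dot x u
  ... | false = refl
  ... | true  = refl

  sift : ∀ {N} (c : Bits N → ℚ) (z : Bits N) → Σᶜ N (λ y → c y * δ y z) ≡ c z
  sift c [] = solve 1 (λ a → a :* con 1ℚ :+ con 0ℚ := a) refl (c [])
  sift {suc N} c (false ∷ z) = begin
    Σᶜ (suc N) (λ y → c y * δ y (false ∷ z))
      ≡⟨ Σᶜ-suc N _ ⟩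
    Σᶜ N (λ y → c (false ∷ y) * δ y z) + Σᶜ N (λ y → c (true ∷ y) * 0ℚ)
      ≡⟨ cong₂ _+_ (sift (c ∘ (false ∷_)) z) (sumOver-zero (allBits N) _ (λ y → *-zeroʳ (c (true ∷ y)))) ⟩
    c (false ∷ z) + 0ℚ
      ≡⟨ +-identityʳ _ ⟩
    c (false ∷ z) ∎
  sift {suc N} c (true ∷ z) = begin
    Σᶜ (suc N) (λ y → c y * δ y (true ∷ z))
      ≡⟨ Σᶜ-suc N _ ⟩
    Σᶜ N (λ y → c (false ∷ y) * 0ℚ) + Σᶜ N (λ y → c (true ∷ y) * δ y z)
      ≡⟨ cong₂ _+_ (sumOver-zero (allBits N) _ (λ y → *-zeroʳ (c (false ∷ y)))) (sift (c ∘ (true ∷_)) z) ⟩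
    0ℚ + c (true ∷ z)
      ≡⟨ +-identityˡ _ ⟩
    c (true ∷ z) ∎

  δ-injective : ∀ {M N} (f : Bits M → Bits N) → (∀ u v → f u ≡ f v → u ≡ v) →
                ∀ u v → δ (f u) (f v) ≡ δ u v
  δ-injective f f-inj u v with ≡-dec _≟ᴮ_ u v
  ... | yes refl = δ-refl (f u)
  ... | no u≢v   = δ-distinct (u≢v ∘ f-inj u v)

  -- Splitting off the first coordinate, the sum for (a ∷ u, b ∷ v) is S + (-1)^{a+b} S, where S is
  -- the sum for (u, v); halving it gives δ u v if a = b and 0 otherwise.
  orthogonality : ∀ {N} (u v : Bits N) → halfPow N * Σᶜ N (λ x → χ u x * χ v x) ≡ δ u v
  orthogonality []      []      = refl
  orthogonality {suc N} (a ∷ u) (b ∷ v) = begin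
    ½ * h * Σᶜ (suc N) (λ x → χ (a ∷ u) x * χ (b ∷ v) x)
      ≡⟨ cong (½ * h *_) (Σᶜ-suc N _) ⟩
    ½ * h * (S + Σᶜ N (λ x → χ (a ∷ u) (true ∷ x) * χ (b ∷ v) (true ∷ x)))
      ≡⟨ cong (λ t → ½ * h * (S + t)) leading-one ⟩
    ½ * h * (S + sign a * sign b * S)
      ≡⟨ solve 4 (λ h S p q → con ½ :* h :* (S :+ p :* q :* S) := con ½ :* (h :* S :+ p :* q :* (h :* S)))
               refl h S (sign a) (sign b) ⟩
    ½ * (h * S + sign a * sign b * (h * S))
      ≡⟨ cong (λ d → ½ * (d + sign a * sign b * d)) (orthogonality u v) ⟩
    ½ * (δ u v + sign a * sign b * δ u v)
      ≡⟨ halve a b ⟩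
    δ (a ∷ u) (b ∷ v) ∎
    where
    h = halfPow N
    S = Σᶜ N (λ x → χ u x * χ v x)

    leading-one : Σᶜ N (λ x → χ (a ∷ u) (true ∷ x) * χ (b ∷ v) (true ∷ x)) ≡ sign a * sign b * S
    leading-one = trans
      (sumOver-cong (allBits N) (λ x → trans (cong₂ _*_ (χ-true a u x) (χ-true b v x))
        (solve 4 (λ p q r s → (p :* r) :* (q :* s) := (p :* q) :* (r :* s)) refl (sign a) (sign b) (χ u x) (χ v x))))
      (sumOver-*ˡ (allBits N) (sign a * sign b) _)

    halve : ∀ a b → ½ * (δ u v + sign a * sign b * δ u v) ≡ δ (a ∷ u) (b ∷ v)
    halve false false = solve 1 (λ d → con ½ :* (d :+ con 1ℚ :* con 1ℚ :* d) := d) refl (δ u v)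
    halve true  true  = solve 1 (λ d → con ½ :* (d :+ con (- 1ℚ) :* con (- 1ℚ) :* d) := d) refl (δ u v)
    halve false true  = solve 1 (λ d → con ½ :* (d :+ con 1ℚ :* con (- 1ℚ) :* d) := con 0ℚ) refl (δ u v)
    halve true  false = solve 1 (λ d → con ½ :* (d :+ con (- 1ℚ) :* con 1ℚ :* d) := con 0ℚ) refl (δ u v)

  scaled-orthogonality : ∀ {N} (c : ℚ) (u v : Bits N) →
                         halfPow N * (c * Σᶜ N (λ x → χ u x * χ v x)) ≡ c * δ u v
  scaled-orthogonality {N} c u v =
    trans (solve 3 (λ h c S → h :* (c :* S) := c :* (h :* S)) refl (halfPow N) c _)
          (cong (c *_) (orthogonality u v))

  inversion : ∀ {N} (Q : Bits N → ℚ) (z : Bits N) → Σᶜ N (λ w → transform Q w * χ w z) ≡ Q z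
  inversion {N} Q z = begin
    Σᶜ N (λ w → h * Σᶜ N (λ y → Q y * χ w y) * χ w z)
      ≡⟨ sumOver-cong B (λ w → trans (*-assoc h _ _) (cong (h *_) (sym (sumOver-*ʳ B (χ w z) _)))) ⟩
    Σᶜ N (λ w → h * Σᶜ N (λ y → Q y * χ w y * χ w z))
      ≡⟨ sumOver-*ˡ B h _ ⟩
    h * Σᶜ N (λ w → Σᶜ N (λ y → Q y * χ w y * χ w z))
      ≡⟨ cong (h *_) (sumOver-swap B B _) ⟩
    h * Σᶜ N (λ y → Σᶜ N (λ w → Q y * χ w y * χ w z))
      ≡⟨ cong (h *_) (sumOver-cong B factor-out) ⟩
    h * Σᶜ N (λ y → Q y * Σᶜ N (λ w → χ y w * χ z w))
      ≡⟨ sym (sumOver-*ˡ B h _) ⟩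
    Σᶜ N (λ y → h * (Q y * Σᶜ N (λ w → χ y w * χ z w)))
      ≡⟨ sumOver-cong B (λ y → scaled-orthogonality (Q y) y z) ⟩
    Σᶜ N (λ y → Q y * δ y z)
      ≡⟨ sift Q z ⟩
    Q z ∎
    where
    h = halfPow N
    B = allBits N
    factor-out : ∀ y → Σᶜ N (λ w → Q y * χ w y * χ w z) ≡ Q y * Σᶜ N (λ w → χ y w * χ z w)
    factor-out y = trans
      (sumOver-cong B (λ w → trans (*-assoc (Q y) _ _) (cong (Q y *_) (cong₂ _*_ (χ-sym w y) (χ-sym w z)))))
      (sumOver-*ˡ B (Q y) _)

  -- The composition formula (Q ∘ A)^(v) = Σ_w Q̂(w) [Aᵀ w = v]: expand Q(A x) by inversion,
  -- move A across the inner product, and apply orthogonality in x.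
  transform-∘ : ∀ {n m} (A : Fin m → Fin n → Bool) (Q : Bits m → ℚ) (v : Bits n) →
                transform (λ x → Q (apply A x)) v ≡ Σᶜ m (λ w → transform Q w * δ (applyᵀ A w) v)
  transform-∘ {n} {m} A Q v = begin
    h * Σᶜ n (λ x → Q (apply A x) * χ v x)
      ≡⟨ cong (h *_) (sumOver-cong (allBits n) expand) ⟩
    h * Σᶜ n (λ x → Σᶜ m (λ w → Q̂ w * (χ (applyᵀ A w) x * χ v x)))
      ≡⟨ cong (h *_) (sumOver-swap (allBits n) (allBits m) _) ⟩
    h * Σᶜ m (λ w → Σᶜ n (λ x → Q̂ w * (χ (applyᵀ A w) x * χ v x)))
      ≡⟨ cong (h *_) (sumOver-cong (allBits m) (λ w → sumOver-*ˡ (allBits n) (Q̂ w) _)) ⟩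
    h * Σᶜ m (λ w → Q̂ w * Σᶜ n (λ x → χ (applyᵀ A w) x * χ v x))
      ≡⟨ sym (sumOver-*ˡ (allBits m) h _) ⟩
    Σᶜ m (λ w → h * (Q̂ w * Σᶜ n (λ x → χ (applyᵀ A w) x * χ v x)))
      ≡⟨ sumOver-cong (allBits m) (λ w → scaled-orthogonality (Q̂ w) (applyᵀ A w) v) ⟩
    Σᶜ m (λ w → Q̂ w * δ (applyᵀ A w) v) ∎
    where
    h = halfPow n
    Q̂ = transform Q
    expand : ∀ x → Q (apply A x) * χ v x ≡ Σᶜ m (λ w → Q̂ w * (χ (applyᵀ A w) x * χ v x))
    expand x = begin
      Q (apply A x) * χ v x
        ≡⟨ cong (_* χ v x) (sym (inversion Q (apply A x))) ⟩
      Σᶜ m (λ w → Q̂ w * χ w (apply A x)) * χ v x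
        ≡⟨ sym (sumOver-*ʳ (allBits m) (χ v x) _) ⟩
      Σᶜ m (λ w → Q̂ w * χ w (apply A x) * χ v x)
        ≡⟨ sumOver-cong (allBits m) (λ w → trans (*-assoc (Q̂ w) _ _)
             (cong (λ t → Q̂ w * (sign t * χ v x)) (transpose A x w))) ⟩
      Σᶜ m (λ w → Q̂ w * (χ (applyᵀ A w) x * χ v x)) ∎

  transform-∘-off-image : ∀ {n m} (A : Fin m → Fin n → Bool) (Q : Bits m → ℚ) (v : Bits n) →
                          ¬ (∃[ w ] v ≡ applyᵀ A w) → transform (λ x → Q (apply A x)) v ≡ 0ℚ
  transform-∘-off-image A Q v v∉image = trans (transform-∘ A Q v)
    (sumOver-zero (allBits _) _ (λ w →
      trans (cong (transform Q w *_) (δ-distinct (λ Aᵀw≡v → v∉image (w , sym Aᵀw≡v)))) (*-zeroʳ (transform Q w))))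

  transform-∘-on-image : ∀ {n m} (A : Fin m → Fin n → Bool) (Q : Bits m → ℚ) →
                         (∀ w w′ → applyᵀ A w ≡ applyᵀ A w′ → w ≡ w′) →
                         ∀ w₀ → transform (λ x → Q (apply A x)) (applyᵀ A w₀) ≡ transform Q w₀
  transform-∘-on-image {m = m} A Q Aᵀ-inj w₀ = begin
    transform (λ x → Q (apply A x)) (applyᵀ A w₀)
      ≡⟨ transform-∘ A Q (applyᵀ A w₀) ⟩
    Σᶜ m (λ w → transform Q w * δ (applyᵀ A w) (applyᵀ A w₀))
      ≡⟨ sumOver-cong (allBits m) (λ w → cong (transform Q w *_) (δ-injective (applyᵀ A) Aᵀ-inj w w₀)) ⟩
    Σᶜ m (λ w → transform Q w * δ w w₀)
      ≡⟨ sift (transform Q) w₀ ⟩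
    transform Q w₀ ∎

module MatchingFacts {n m : ℕ} (M : Matching n m) where

  incident? : ∀ e u → Dec (Incident M e u)
  incident? e u = (u ≟ end₁ M e) ⊎-dec (u ≟ end₂ M e)

  incidence-true : ∀ {e u} → Incident M e u → incidence M e u ≡ true
  incidence-true {e} {u} i =
    trans (cong₂ _∨_ (isYes≗does (u ≟ end₁ M e)) (isYes≗does (u ≟ end₂ M e))) (dec-true (incident? e u) i)

  incidence-false : ∀ {e u} → ¬ Incident M e u → incidence M e u ≡ false
  incidence-false {e} {u} ¬i =
    trans (cong₂ _∨_ (isYes≗does (u ≟ end₁ M e)) (isYes≗does (u ≟ end₂ M e))) (dec-false (incident? e u) ¬i)

  incident-unique : ∀ {e e′ u} → Incident M e u → Incident M e′ u → e ≡ e′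
  incident-unique {e} {e′} i i′ =
    decidable-stable (e ≟ e′) (λ e≢e′ → clash i i′ (disjoint M e e′ e≢e′))
    where
    clash : ∀ {u} → Incident M e u → Incident M e′ u →
            (end₁ M e ≢ end₁ M e′) × (end₁ M e ≢ end₂ M e′) × (end₂ M e ≢ end₁ M e′) × (end₂ M e ≢ end₂ M e′) →
            ⊥
    clash (inj₁ p) (inj₁ q) (d₁₁ , _ , _ , _) = d₁₁ (trans (sym p) q)
    clash (inj₁ p) (inj₂ q) (_ , d₁₂ , _ , _) = d₁₂ (trans (sym p) q)
    clash (inj₂ p) (inj₁ q) (_ , _ , d₂₁ , _) = d₂₁ (trans (sym p) q)
    clash (inj₂ p) (inj₂ q) (_ , _ , _ , d₂₂) = d₂₂ (trans (sym p) q)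

  covered? : ∀ u → Dec (∃[ e ] Incident M e u)
  covered? u = any? (λ e → incident? e u)

  module ColumnSum {c ℓ} (C : CommutativeMonoid c ℓ) where
    open CommutativeMonoid C using (Carrier; _≈_; ε)
    open CommutativeMonoidSum C using (sum)

    column-sum : ∀ {e u} (φ : Fin m → Carrier) → (∀ e′ → ¬ Incident M e′ u → φ e′ ≈ ε) →
                 Incident M e u → sum φ ≈ φ e
    column-sum φ φ-off i =
      SupportedSums.sum-single C φ _ (λ e′ e′≢e → φ-off e′ (λ i′ → e′≢e (incident-unique i′ i)))

  covers : Bits m → Fin n → Fin m → Bool
  covers w u e = incidence M e u ∧ lookup w e

  covers-off : ∀ w {u e} → ¬ Incident M e u → covers w u e ≡ false
  covers-off w {e = e} ¬i = cong (_∧ lookup w e) (incidence-false ¬i)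

  covers-on : ∀ w {u e} → Incident M e u → covers w u e ≡ lookup w e
  covers-on w {e = e} i = cong (_∧ lookup w e) (incidence-true i)

  mulMT-column : ∀ w u → lookup (mulMT M w) u ≡ ⊕.sum (covers w u)
  mulMT-column w u = trans (lookup∘tabulate _ u) (dot-tabulate _ w)

  mulMT-covered : ∀ w {e u} → Incident M e u → lookup (mulMT M w) u ≡ lookup w e
  mulMT-covered w {e} {u} i = begin
    lookup (mulMT M w) u  ≡⟨ mulMT-column w u ⟩
    ⊕.sum (covers w u)    ≡⟨ ColumnSum.column-sum (Semiring.+-commutativeMonoid GF₂) (covers w u) (λ _ → covers-off w) i ⟩
    covers w u e          ≡⟨ covers-on w i ⟩
    lookup w e            ∎
    where open ≡-Reasoning

  mulMT-uncovered : ∀ w {u} → ¬ (∃[ e ] Incident M e u) → lookup (mulMT M w) u ≡ false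
  mulMT-uncovered w {u} uncovered =
    trans (mulMT-column w u) (⊕-support.sum-zero (covers w u) (λ e → covers-off w (λ i → uncovered (e , i))))

  mulMT-covers : ∀ w u → (lookup (mulMT M w) u ≡ true) ⇔ (∃[ e ] (lookup w e ≡ true × Incident M e u))
  mulMT-covers w u with covered? u
  ... | yes (e , i) = mk⇔
    (λ Mᵀwᵤ → e , trans (sym (mulMT-covered w i)) Mᵀwᵤ , i)
    (λ { (e′ , wₑ′ , i′) → trans (mulMT-covered w i) (subst (λ d → lookup w d ≡ true) (incident-unique i′ i) wₑ′) })
  ... | no uncovered = mk⇔
    (λ Mᵀwᵤ → contradiction (trans (sym (mulMT-uncovered w uncovered)) Mᵀwᵤ) (λ ()))
    (λ { (e′ , _ , i′) → contradiction (e′ , i′) uncovered })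

  perfectlyMatches⇔ : ∀ w v → PerfectlyMatches M w v ⇔ (v ≡ mulMT M w)
  perfectlyMatches⇔ w v = mk⇔
    (λ pm → Pointwise-≡⇒≡ (ext (λ u → ⇔→≡ (⇔.trans (pm u) (⇔.sym (mulMT-covers w u))))))
    (λ { refl → mulMT-covers w })

  matchable⇔image : ∀ v → Matchable M v ⇔ (∃[ w ] v ≡ mulMT M w)
  matchable⇔image v = mk⇔
    (λ { (w , pm) → w , Equivalence.to (perfectlyMatches⇔ w v) pm })
    (λ { (w , v≡Mᵀw) → w , Equivalence.from (perfectlyMatches⇔ w v) v≡Mᵀw })

  -- Reading a vertex set at the first endpoint of each edge recovers w from Mᵀ w;
  -- so Mᵀ is injective and membership in its image is decidable.
  restrict : Bits n → Bits m
  restrict v = tabulate (λ e → lookup v (end₁ M e))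

  restrict-mulMT : ∀ w → restrict (mulMT M w) ≡ w
  restrict-mulMT w = Pointwise-≡⇒≡ (ext (λ e → trans (lookup∘tabulate _ e) (mulMT-covered w (inj₁ refl))))

  mulMT-injective : ∀ w w′ → mulMT M w ≡ mulMT M w′ → w ≡ w′
  mulMT-injective w w′ Mᵀw≡Mᵀw′ =
    trans (sym (restrict-mulMT w)) (trans (cong restrict Mᵀw≡Mᵀw′) (restrict-mulMT w′))

  image? : ∀ v → Dec (∃[ w ] v ≡ mulMT M w)
  image? v with ≡-dec _≟ᴮ_ v (mulMT M (restrict v))
  ... | yes v≡ = yes (restrict v , v≡)
  ... | no  v≢ = no (λ { (w , v≡Mᵀw) →
    v≢ (trans v≡Mᵀw (cong (mulMT M) (sym (trans (cong restrict v≡Mᵀw) (restrict-mulMT w))))) })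

  mulMT-count : ∀ w u → bitℕ (lookup (mulMT M w) u) ≡ Σℕ.sum (λ e → bitℕ (covers w u e))
  mulMT-count w u with covered? u
  ... | yes (e , i) = begin
    bitℕ (lookup (mulMT M w) u)          ≡⟨ cong bitℕ (mulMT-covered w i) ⟩
    bitℕ (lookup w e)                    ≡⟨ cong bitℕ (sym (covers-on w i)) ⟩
    bitℕ (covers w u e)                  ≡⟨ sym (ColumnSum.column-sum (Semiring.+-commutativeMonoid ℕ.+-*-semiring)
                                               (bitℕ ∘ covers w u) (λ _ ¬i → cong bitℕ (covers-off w ¬i)) i) ⟩
    Σℕ.sum (λ e′ → bitℕ (covers w u e′)) ∎
    where open ≡-Reasoning
  ... | no uncovered = trans (cong bitℕ (mulMT-uncovered w uncovered))
    (sym (Σℕ-support.sum-zero _ (λ e → cong bitℕ (covers-off w (λ i → uncovered (e , i))))))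

  edge-degree : ∀ e → Σℕ.sum (λ u → bitℕ (incidence M e u)) ≡ 2
  edge-degree e = begin
    Σℕ.sum (λ u → bitℕ (incidence M e u))
      ≡⟨ Σℕ.sum-cong-≗ endpoints ⟩
    Σℕ.sum (λ u → bitℕ (does (u ≟ end₁ M e)) ℕ.+ bitℕ (does (u ≟ end₂ M e)))
      ≡⟨ Σℕ.∑-distrib-+ (λ u → bitℕ (does (u ≟ end₁ M e))) (λ u → bitℕ (does (u ≟ end₂ M e))) ⟩
    Σℕ.sum (λ u → bitℕ (does (u ≟ end₁ M e))) ℕ.+ Σℕ.sum (λ u → bitℕ (does (u ≟ end₂ M e)))
      ≡⟨ cong₂ ℕ._+_ (point-mass (end₁ M e)) (point-mass (end₂ M e)) ⟩
    2 ∎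
    where
    open ≡-Reasoning
    endpoints : ∀ u → bitℕ (incidence M e u) ≡ bitℕ (does (u ≟ end₁ M e)) ℕ.+ bitℕ (does (u ≟ end₂ M e))
    endpoints u with u ≟ end₁ M e | u ≟ end₂ M e
    ... | yes u≡end₁ | yes u≡end₂ = contradiction (trans (sym u≡end₁) u≡end₂) (proper M e)
    ... | yes _      | no _       = refl
    ... | no _       | yes _      = refl
    ... | no _       | no _       = refl

  edge-contribution : ∀ e b → Σℕ.sum (λ u → bitℕ (incidence M e u ∧ b)) ≡ 2 ℕ.* bitℕ b
  edge-contribution e true  = trans (Σℕ.sum-cong-≗ {n} (λ u → cong bitℕ (∧-identityʳ (incidence M e u))))
                                    (edge-degree e)
  edge-contribution e false = Σℕ-support.sum-zero {n} _ (λ u → cong bitℕ (∧-zeroʳ (incidence M e u)))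

  -- Double counting of vertex-edge incidences: weight (Mᵀ w) = 2 · weight w.
  weight-mulMT : ∀ w → weight (mulMT M w) ≡ 2 ℕ.* weight w
  weight-mulMT w = begin
    weight (mulMT M w)                                 ≡⟨ weight-sum (mulMT M w) ⟩
    Σℕ.sum (λ u → bitℕ (lookup (mulMT M w) u))         ≡⟨ Σℕ.sum-cong-≗ (mulMT-count w) ⟩
    Σℕ.sum (λ u → Σℕ.sum (λ e → bitℕ (covers w u e)))  ≡⟨ Σℕ.∑-comm (λ u e → bitℕ (covers w u e)) ⟩
    Σℕ.sum (λ e → Σℕ.sum (λ u → bitℕ (covers w u e)))  ≡⟨ Σℕ.sum-cong-≗ (λ e → edge-contribution e (lookup w e)) ⟩
    Σℕ.sum (λ e → 2 ℕ.* bitℕ (lookup w e))             ≡⟨ sym (Σℕ.*-distribˡ-sum 2 (λ e → bitℕ (lookup w e))) ⟩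
    2 ℕ.* Σℕ.sum (λ e → bitℕ (lookup w e))             ≡⟨ cong (2 ℕ.*_) (sym (weight-sum w)) ⟩
    2 ℕ.* weight w                                     ∎
    where open ≡-Reasoning

open import Data.Nat using (_<_; _*_)
open import Data.Rational using (0ℚ)

lemma5 : (n m s : ℕ) → 0 < s → (M : Matching n m) → (g : Bits m → Bits s) → (a : Bits s) →
    ((v : Bits n) → ¬ Matchable M v → fourier (λ x → indicator g a (mulM M x)) v ≡ 0ℚ)
    × ((v : Bits n) (w : Bits m) → PerfectlyMatches M w v →
         fourier (λ x → indicator g a (mulM M x)) v ≡ fourier (indicator g a) w)
    × ((v : Bits n) (w w′ : Bits m) → PerfectlyMatches M w v → PerfectlyMatches M w′ v → w ≡ w′)
    × ((v : Bits n) → Matchable M v ⇔ (∃[ w ] v ≡ mulMT M w))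
    × ((w : Bits m) → fourier (λ x → indicator g a (mulM M x)) (mulMT M w) ≡ fourier (indicator g a) w)
    × ((v : Bits n) → fourier (λ x → indicator g a (mulM M x)) v ≢ 0ℚ → ∃[ w ] v ≡ mulMT M w)
    × ((w w′ : Bits m) → mulMT M w ≡ mulMT M w′ → w ≡ w′)
    × ((k : ℕ) (w : Bits m) → weight w ≡ k → fourier (indicator g a) w ≢ 0ℚ →
         weight (mulMT M w) ≡ 2 * k × fourier (λ x → indicator g a (mulM M x)) (mulMT M w) ≢ 0ℚ)
    × ((k : ℕ) (v : Bits n) → weight v ≡ 2 * k → fourier (λ x → indicator g a (mulM M x)) v ≢ 0ℚ →
         ∃[ w ] (v ≡ mulMT M w × weight w ≡ k × fourier (indicator g a) w ≢ 0ℚ))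
lemma5 n m s _ M g a =
    (λ v unmatchable → off-image v (unmatchable ∘ Equivalence.from (matchable⇔image v)))
  , (λ v w pm → trans (cong f̂ (matched v w pm)) (on-image w))
  , (λ v w w′ pm pm′ → mulMT-injective w w′ (trans (sym (matched v w pm)) (matched v w′ pm′)))
  , matchable⇔image
  , on-image
  , nonzero⇒image
  , mulMT-injective
  , (λ k w wt≡k q̂≢0 → trans (weight-mulMT w) (cong (2 *_) wt≡k) , q̂≢0 ∘ trans (sym (on-image w)))
  , λ k v wt≡2k f̂≢0 → let (w , v≡Mᵀw) = nonzero⇒image v f̂≢0 in
      w , v≡Mᵀw
        , ℕ.*-cancelˡ-≡ (weight w) k 2 (trans (sym (weight-mulMT w)) (trans (cong weight (sym v≡Mᵀw)) wt≡2k))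
        , f̂≢0 ∘ trans (trans (cong f̂ v≡Mᵀw) (on-image w))
  where
  open MatchingFacts M
  q = indicator g a
  f̂ = fourier (λ x → q (mulM M x))

  matched : ∀ v w → PerfectlyMatches M w v → v ≡ mulMT M w
  matched v w = Equivalence.to (perfectlyMatches⇔ w v)

  -- f = q ∘ M, and Fourier analysis applies since Mᵀ is injective.
  on-image : ∀ w → f̂ (mulMT M w) ≡ fourier q w
  on-image = Fourier.transform-∘-on-image (incidence M) (boolℚ ∘ q) mulMT-injective

  off-image : ∀ v → ¬ (∃[ w ] v ≡ mulMT M w) → f̂ v ≡ 0ℚ
  off-image = Fourier.transform-∘-off-image (incidence M) (boolℚ ∘ q)

  nonzero⇒image : ∀ v → f̂ v ≢ 0ℚ → ∃[ w ] v ≡ mulMT M w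
  nonzero⇒image v f̂≢0 = decidable-stable (image? v) (f̂≢0 ∘ off-image v)
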